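{- Let $\Gamma_1,\Gamma_2,\dots,\Gamma_d$ be finite nonempty alphabets and let $C \subseteq [|\Gamma_1|] \times [|\Gamma_2|] \times \dots \times [|\Gamma_d|]$ with $|C| \ge 2$. Let $t = \min_{c_1,c_2 \in C,\, c_1 \neq c_2} H(c_1,c_2)$. Then: (1) If $t = \sum_{\ell=1}^d \frac{|\Gamma_{\ell}|-1}{|\Gamma_{\ell}|}$, then $|C| \le 2\sum_{\ell=1}^d |\Gamma_{\ell}|$; (2) If $t > \sum_{\ell=1}^d \frac{|\Gamma_{\ell}|-1}{|\Gamma_{\ell}|}$, then $|C| \le \frac{t}{t-\sum_{\ell=1}^d \frac{|\Gamma_{\ell}|-1}{|\Gamma_{\ell}|}}$.
   Context: For $m \ge 1$, $[m] = \{1,\dots,m\}$. For tuples $c, c'$ of length $d$, $H(c,c') = |\{i \in [d] : c_i \neq c'_i\}|$ is the Hamming distance. -}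

module Defs where

open import Data.Nat as ℕ using (ℕ; NonZero)
open import Data.Fin using (Fin; zero; suc)
open import Data.Fin.Properties using (_≟_)
open import Data.List using (length; filter; allFin)
open import Data.Integer using (+_)
open import Data.Rational as ℚ using (ℚ; 0ℚ; _+_; _-_; _<_; _÷_)
open import Data.Rational.Properties using (+-assoc; +-inverseˡ; +-identityʳ; +-identityˡ; <⇒≢)
open import Relation.Nullary using (¬?; ¬_)
open import Data.Product using (_×_; Σ)
open import Relation.Binary.PropositionalEquality

-- Words of length d over alphabets [q 0], ..., [q (d-1)]  (Fin (q l) ≅ [|Γ_l|])
Word : (d : ℕ) → (Fin d → ℕ) → Set
Word d q = (l : Fin d) → Fin (q l)

H : ∀ {d} {q : Fin d → ℕ} → Word d q → Word d q → ℕ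
H {d} c c' = length (filter (λ l → ¬? (c l ≟ c' l)) (allFin d))

sumFin : (d : ℕ) → (Fin d → ℚ) → ℚ
sumFin ℕ.zero    f = 0ℚ
sumFin (ℕ.suc d) f = f zero + sumFin d (λ l → f (suc l))

S : (d : ℕ) (q : Fin d → ℕ) → (∀ l → NonZero (q l)) → ℚ
S d q nz = sumFin d (λ l → ℚ._/_ (+ (q l ℕ.∸ 1)) (q l) {{nz l}})

IsMinDist : ∀ {d} {q : Fin d → ℕ} {m} → (Fin m → Word d q) → ℕ → Set
IsMinDist {m = m} C t =
  (∀ (i j : Fin m) → i ≢ j → t ℕ.≤ H (C i) (C j)) ×
  (Σ (Fin m) λ i → Σ (Fin m) λ j → (i ≢ j) × (H (C i) (C j) ≡ t))

private
  sub0⇒≡ : ∀ (t s : ℚ) → t - s ≡ 0ℚ → t ≡ s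
  sub0⇒≡ t s e = begin
    t                  ≡⟨ sym (+-identityʳ t) ⟩
    t + 0ℚ             ≡⟨ cong (λ x → t + x) (sym (+-inverseˡ s)) ⟩
    t + (ℚ.- s + s)    ≡⟨ sym (+-assoc t (ℚ.- s) s) ⟩
    (t - s) + s        ≡⟨ cong (λ x → x + s) e ⟩
    0ℚ + s             ≡⟨ +-identityˡ s ⟩
    s ∎
    where open ≡-Reasoning

bound : (t s : ℚ) → s < t → ℚ
bound t s s<t = _÷_ t (t - s) {{ℚ.≢-nonZero (λ e → <⇒≢ s<t (sym (sub0⇒≡ t s e)))}}

sumNat : (d : ℕ) → (Fin d → ℕ) → ℕ
sumNat ℕ.zero    f = 0
sumNat (ℕ.suc d) f = f zero ℕ.+ sumNat d (λ l → f (suc l))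

Distinct : ∀ {d} {q : Fin d → ℕ} {m} → (Fin m → Word d q) → Set
Distinct {m = m} C = ∀ (i j : Fin m) → i ≢ j → ¬ (∀ l → C i l ≡ C j l)

-- Put a 0/1 weight w on the codewords, let M = Σ w, and count ordered pairs of weighted codewords.
-- Summed over pairs, the Hamming distance is at least t M² − t M, because distinct codewords are at
-- distance ≥ t.  Summed over coordinates it is at most M² S: in a coordinate with q letters whose
-- weighted frequencies are N_a, the agreeing pairs number Σ N_a² ≥ M²/q by Cauchy–Schwarz, so at most
-- (1 − 1/q) M² pairs disagree.  Hence M (t − S) ≤ t.
-- With all weights 1 this is part (2).  For part (1), where t = S, pick a coordinate l₀ whose alphabet
-- is smallest among those with at least two letters (one exists since C has two distinct words), and
-- weight the codewords carrying the most frequent letter a there.  Coordinate l₀ then contributes no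
-- disagreement, so S drops by (q₀ − 1)/q₀ ≥ 1/2 and the fibre has M ≤ 2t codewords; pigeonhole gives
-- m ≤ q₀ M, and minimality of q₀ gives q₀ t = q₀ S ≤ Σ |Γ_l|.

module Submission where

open import Defs
open import Algebra.Bundles using (Ring)
open import Data.Nat using (ℕ; zero; suc; NonZero; _+_; _*_; _∸_; _≤_; _≤?_; z≤n; s≤s)
open import Data.Nat.Properties hiding (_≟_)
open import Data.Nat.Tactic.RingSolver using (solve-∀)
open import Algebra.Properties.CommutativeSemigroup *-commutativeSemigroup using (x∙yz≈y∙xz)
open import Algebra.Properties.Semiring.Sum +-*-semiring
  using (sum-syntax; sum-cong-≗; ∑-comm; ∑-distrib-+; *-distribˡ-sum; *-distribʳ-sum; sum-replicate-zero)
open import Data.Bool using (true; false; if_then_else_)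
open import Data.Fin using (Fin; zero; suc; punchIn)
open import Data.Fin.Properties using (_≟_; ¬∀⟶∃¬)
open import Data.List using (length; filter; tabulate; allFin)
open import Data.List.Extrema.Nat using (argmax; argmin; f[xs]≤f[argmax]; f[argmin]≤f[xs]; argmin-all)
open import Data.List.Membership.Propositional.Properties using (∈-allFin; ∈-filter⁺)
import Data.List.Relation.Unary.All as All
open import Data.List.Relation.Unary.All.Properties using (all-filter)
open import Data.Integer as ℤ using (+_)
import Data.Integer.Properties as ℤ
open import Data.Rational as ℚ using (ℚ; mkℚ; _/_; _<_; *≤*)
import Data.Rational.Properties as ℚ
import Data.Rational.Unnormalised as ℚᵘ
import Data.Rational.Unnormalised.Properties as ℚᵘ
open import Data.Rational.Solver using (module +-*-Solver)
import Algebra.Properties.Semiring.Sum (Ring.semiring ℚ.+-*-ring) as ℚΣ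
import Data.Nat.Coprimality as Coprime
open import Data.Vec.Functional using (removeAt)
open import Data.Product using (_×_; _,_; ∃-syntax)
open import Data.Sum using (inj₁; inj₂)
open import Function using (_∘_; _⇔_; mk⇔; Equivalence)
open import Relation.Nullary using (Dec; yes; no; does; ¬?; contradiction)
open import Relation.Unary using (Pred; Decidable)
open import Relation.Binary.PropositionalEquality

𝟙 : ∀ {P : Set} → Dec P → ℕ
𝟙 P? = if does P? then 1 else 0

𝟙-¬?+𝟙 : ∀ {P : Set} (P? : Dec P) → 𝟙 (¬? P?) + 𝟙 P? ≡ 1
𝟙-¬?+𝟙 (yes _) = refl
𝟙-¬?+𝟙 (no _)  = refl

𝟙*𝟙 : ∀ {P : Set} (P? : Dec P) → 𝟙 P? * 𝟙 P? ≡ 𝟙 P?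
𝟙*𝟙 (yes _) = refl
𝟙*𝟙 (no _)  = refl

sumNat≡∑ : ∀ n (f : Fin n → ℕ) → sumNat n f ≡ ∑[ i < n ] f i
sumNat≡∑ zero    f = refl
sumNat≡∑ (suc n) f = cong (_+_ (f zero)) (sumNat≡∑ n (f ∘ suc))

∑-mono-≤ : ∀ {n} {f g : Fin n → ℕ} → (∀ i → f i ≤ g i) → ∑[ i < n ] f i ≤ ∑[ i < n ] g i
∑-mono-≤ {zero}  f≤g = z≤n
∑-mono-≤ {suc n} f≤g = +-mono-≤ (f≤g zero) (∑-mono-≤ (f≤g ∘ suc))

∑-const : ∀ n c → ∑[ i < n ] c ≡ n * c
∑-const zero    c = refl
∑-const (suc n) c = cong (_+_ c) (∑-const n c)

∑-𝟙≟ : ∀ {n} (x : Fin n) (g : Fin n → ℕ) → ∑[ a < n ] (𝟙 (x ≟ a) * g a) ≡ g x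
∑-𝟙≟ {suc n} zero    g =
  trans (cong₂ _+_ (+-identityʳ (g zero)) (sum-replicate-zero n)) (+-identityʳ (g zero))
∑-𝟙≟ {suc n} (suc x) g = ∑-𝟙≟ x (g ∘ suc)

∑*∑ : ∀ {m n} (f : Fin m → ℕ) (g : Fin n → ℕ) →
      ∑[ i < m ] f i * ∑[ j < n ] g j ≡ ∑[ i < m ] ∑[ j < n ] (f i * g j)
∑*∑ f g = trans (*-distribʳ-sum _ f) (sum-cong-≗ (λ i → *-distribˡ-sum (f i) g))

2*≤+-ordered : ∀ {a b} → a ≤ b → 2 * (a * b) ≤ a * a + b * b
2*≤+-ordered {a} {b} a≤b = subst (λ b → 2 * (a * b) ≤ a * a + b * b) (m+[n∸m]≡n a≤b)
  (subst (2 * (a * (a + k)) ≤_) (sym (gap a k)) (m≤m+n _ (k * k)))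
  where
  k = b ∸ a
  gap : ∀ a k → a * a + (a + k) * (a + k) ≡ 2 * (a * (a + k)) + k * k
  gap = solve-∀

2*≤+ : ∀ a b → 2 * (a * b) ≤ a * a + b * b
2*≤+ a b with ≤-total a b
... | inj₁ a≤b = 2*≤+-ordered a≤b
... | inj₂ b≤a =
  subst₂ _≤_ (cong (2 *_) (*-comm b a)) (+-comm (b * b) (a * a)) (2*≤+-ordered b≤a)

cauchy-schwarz : ∀ {n} (f : Fin n → ℕ) →
                 ∑[ i < n ] f i * ∑[ i < n ] f i ≤ n * ∑[ i < n ] (f i * f i)
cauchy-schwarz {n} f = *-cancelˡ-≤ 2 (begin
  2 * (Σf * Σf)
    ≡⟨ cong (2 *_) (∑*∑ f f) ⟩
  2 * ∑[ i < n ] ∑[ j < n ] (f i * f j)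
    ≡⟨ *-distribˡ-sum 2 (λ i → ∑[ j < n ] (f i * f j)) ⟩
  ∑[ i < n ] (2 * ∑[ j < n ] (f i * f j))
    ≡⟨ sum-cong-≗ (λ i → *-distribˡ-sum 2 (λ j → f i * f j)) ⟩
  ∑[ i < n ] ∑[ j < n ] (2 * (f i * f j))
    ≤⟨ ∑-mono-≤ (λ i → ∑-mono-≤ (λ j → 2*≤+ (f i) (f j))) ⟩
  ∑[ i < n ] ∑[ j < n ] (f i * f i + f j * f j)
    ≡⟨ sum-cong-≗ (λ i → ∑-distrib-+ (λ _ → f i * f i) (λ j → f j * f j)) ⟩
  ∑[ i < n ] (∑[ j < n ] (f i * f i) + Σf²)
    ≡⟨ ∑-distrib-+ (λ i → ∑[ j < n ] (f i * f i)) (λ _ → Σf²) ⟩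
  ∑[ i < n ] ∑[ j < n ] (f i * f i) + ∑[ i < n ] Σf²
    ≡⟨ cong₂ _+_ (sum-cong-≗ (λ i → ∑-const n (f i * f i))) (∑-const n Σf²) ⟩
  ∑[ i < n ] (n * (f i * f i)) + n * Σf²
    ≡⟨ cong (_+ n * Σf²) (*-distribˡ-sum n (λ i → f i * f i)) ⟨
  n * Σf² + n * Σf²
    ≡⟨ cong (_+_ (n * Σf²)) (+-identityʳ (n * Σf²)) ⟨
  2 * (n * Σf²) ∎)
  where
  open ≤-Reasoning
  Σf  = ∑[ i < n ] f i
  Σf² = ∑[ i < n ] (f i * f i)

length-filter-tabulate : ∀ {A : Set} {P : Pred A _} (P? : Decidable P) {n} (f : Fin n → A) →
                         length (filter P? (tabulate f)) ≡ ∑[ i < n ] 𝟙 (P? (f i))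
length-filter-tabulate P? {zero}  f = refl
length-filter-tabulate P? {suc n} f with does (P? (f zero))
... | true  = cong suc (length-filter-tabulate P? (f ∘ suc))
... | false = length-filter-tabulate P? (f ∘ suc)

H≡∑𝟙≢ : ∀ {d} {q : Fin d → ℕ} (c c' : Word d q) → H c c' ≡ ∑[ l < d ] 𝟙 (¬? (c l ≟ c' l))
H≡∑𝟙≢ c c' = length-filter-tabulate (λ l → ¬? (c l ≟ c' l)) (λ l → l)

-- Weighted counts of ordered pairs of codewords

pairSum : ∀ {m} → (Fin m → ℕ) → (Fin m → Fin m → ℕ) → ℕ
pairSum {m} w f = ∑[ i < m ] ∑[ j < m ] (w i * w j * f i j)

pairSum-cong : ∀ {m} (w : Fin m → ℕ) {f g : Fin m → Fin m → ℕ} →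
               (∀ i j → f i j ≡ g i j) → pairSum w f ≡ pairSum w g
pairSum-cong w f≡g = sum-cong-≗ (λ i → sum-cong-≗ (λ j → cong (w i * w j *_) (f≡g i j)))

pairSum-mono-≤ : ∀ {m} (w : Fin m → ℕ) {f g : Fin m → Fin m → ℕ} →
                 (∀ i j → f i j ≤ g i j) → pairSum w f ≤ pairSum w g
pairSum-mono-≤ w f≤g = ∑-mono-≤ (λ i → ∑-mono-≤ (λ j → *-monoʳ-≤ (w i * w j) (f≤g i j)))

pairSum-+ : ∀ {m} (w : Fin m → ℕ) (f g : Fin m → Fin m → ℕ) →
            pairSum w (λ i j → f i j + g i j) ≡ pairSum w f + pairSum w g
pairSum-+ {m} w f g = trans (sum-cong-≗ row) (∑-distrib-+ (λ i → ∑[ j < m ] (w i * w j * f i j))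
                                                          (λ i → ∑[ j < m ] (w i * w j * g i j)))
  where
  row : ∀ i → ∑[ j < m ] (w i * w j * (f i j + g i j))
            ≡ ∑[ j < m ] (w i * w j * f i j) + ∑[ j < m ] (w i * w j * g i j)
  row i = trans (sum-cong-≗ (λ j → *-distribˡ-+ (w i * w j) (f i j) (g i j)))
                (∑-distrib-+ (λ j → w i * w j * f i j) (λ j → w i * w j * g i j))

pairSum-const : ∀ {m} (w : Fin m → ℕ) c →
                pairSum w (λ _ _ → c) ≡ ∑[ i < m ] w i * ∑[ i < m ] w i * c
pairSum-const {m} w c = begin
  ∑[ i < m ] ∑[ j < m ] (w i * w j * c)
    ≡⟨ sum-cong-≗ (λ i → *-distribʳ-sum c (λ j → w i * w j)) ⟨
  ∑[ i < m ] (∑[ j < m ] (w i * w j) * c)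
    ≡⟨ *-distribʳ-sum c (λ i → ∑[ j < m ] (w i * w j)) ⟨
  ∑[ i < m ] ∑[ j < m ] (w i * w j) * c
    ≡⟨ cong (_* c) (∑*∑ w w) ⟨
  ∑[ i < m ] w i * ∑[ i < m ] w i * c ∎
  where open ≡-Reasoning

pairSum-𝟙≟ : ∀ {m} (w : Fin m → ℕ) c →
             pairSum w (λ i j → 𝟙 (i ≟ j) * c) ≡ ∑[ i < m ] (w i * w i) * c
pairSum-𝟙≟ {m} w c = begin
  ∑[ i < m ] ∑[ j < m ] (w i * w j * (𝟙 (i ≟ j) * c))
    ≡⟨ sum-cong-≗ (λ i → sum-cong-≗ (λ j → rearrange (w i) (w j) (𝟙 (i ≟ j)) c)) ⟩
  ∑[ i < m ] ∑[ j < m ] (𝟙 (i ≟ j) * (w i * w j * c))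
    ≡⟨ sum-cong-≗ (λ i → ∑-𝟙≟ i (λ j → w i * w j * c)) ⟩
  ∑[ i < m ] (w i * w i * c)
    ≡⟨ *-distribʳ-sum c (λ i → w i * w i) ⟨
  ∑[ i < m ] (w i * w i) * c ∎
  where
  open ≡-Reasoning
  rearrange : ∀ x y e c → x * y * (e * c) ≡ e * (x * y * c)
  rearrange = solve-∀

pairSum-∑ : ∀ {m d} (w : Fin m → ℕ) (f : Fin d → Fin m → Fin m → ℕ) →
            pairSum w (λ i j → ∑[ l < d ] f l i j) ≡ ∑[ l < d ] pairSum w (f l)
pairSum-∑ {m} {d} w f = begin
  ∑[ i < m ] ∑[ j < m ] (w i * w j * ∑[ l < d ] f l i j)
    ≡⟨ sum-cong-≗ (λ i → sum-cong-≗ (λ j → *-distribˡ-sum (w i * w j) (λ l → f l i j))) ⟩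
  ∑[ i < m ] ∑[ j < m ] ∑[ l < d ] (w i * w j * f l i j)
    ≡⟨ sum-cong-≗ (λ i → ∑-comm (λ j l → w i * w j * f l i j)) ⟩
  ∑[ i < m ] ∑[ l < d ] ∑[ j < m ] (w i * w j * f l i j)
    ≡⟨ ∑-comm (λ i l → ∑[ j < m ] (w i * w j * f l i j)) ⟩
  ∑[ l < d ] pairSum w (f l) ∎
  where open ≡-Reasoning

-- One coordinate, viewed as a column c of letters

disagreement : ∀ {m q} → (Fin m → ℕ) → (Fin m → Fin q) → ℕ
disagreement w c = pairSum w (λ i j → 𝟙 (¬? (c i ≟ c j)))

agreement : ∀ {m q} → (Fin m → ℕ) → (Fin m → Fin q) → ℕ
agreement w c = pairSum w (λ i j → 𝟙 (c i ≟ c j))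

count : ∀ {m q} → (Fin m → ℕ) → (Fin m → Fin q) → Fin q → ℕ
count {m} w c a = ∑[ i < m ] (w i * 𝟙 (c i ≟ a))

disagreement+agreement : ∀ {m q} (w : Fin m → ℕ) (c : Fin m → Fin q) →
                         disagreement w c + agreement w c ≡ ∑[ i < m ] w i * ∑[ i < m ] w i
disagreement+agreement {m} w c = begin
  disagreement w c + agreement w c
    ≡⟨ pairSum-+ w (λ i j → 𝟙 (¬? (c i ≟ c j))) (λ i j → 𝟙 (c i ≟ c j)) ⟨
  pairSum w (λ i j → 𝟙 (¬? (c i ≟ c j)) + 𝟙 (c i ≟ c j))
    ≡⟨ pairSum-cong w (λ i j → 𝟙-¬?+𝟙 (c i ≟ c j)) ⟩
  pairSum w (λ _ _ → 1)
    ≡⟨ pairSum-const w 1 ⟩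
  ∑[ i < m ] w i * ∑[ i < m ] w i * 1
    ≡⟨ *-identityʳ _ ⟩
  ∑[ i < m ] w i * ∑[ i < m ] w i ∎
  where open ≡-Reasoning

∑-count : ∀ {m q} (w : Fin m → ℕ) (c : Fin m → Fin q) → ∑[ a < q ] count w c a ≡ ∑[ i < m ] w i
∑-count {m} {q} w c = begin
  ∑[ a < q ] ∑[ i < m ] (w i * 𝟙 (c i ≟ a))
    ≡⟨ ∑-comm (λ a i → w i * 𝟙 (c i ≟ a)) ⟩
  ∑[ i < m ] ∑[ a < q ] (w i * 𝟙 (c i ≟ a))
    ≡⟨ sum-cong-≗ (λ i → sum-cong-≗ (λ a → *-comm (w i) (𝟙 (c i ≟ a)))) ⟩
  ∑[ i < m ] ∑[ a < q ] (𝟙 (c i ≟ a) * w i)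
    ≡⟨ sum-cong-≗ (λ i → ∑-𝟙≟ (c i) (λ _ → w i)) ⟩
  ∑[ i < m ] w i ∎
  where open ≡-Reasoning

∑-count² : ∀ {m q} (w : Fin m → ℕ) (c : Fin m → Fin q) →
           ∑[ a < q ] (count w c a * count w c a) ≡ agreement w c
∑-count² {m} {q} w c = begin
  ∑[ a < q ] (count w c a * count w c a)
    ≡⟨ sum-cong-≗ (λ a → ∑*∑ (term a) (term a)) ⟩
  ∑[ a < q ] ∑[ i < m ] ∑[ j < m ] (term a i * term a j)
    ≡⟨ ∑-comm (λ a i → ∑[ j < m ] (term a i * term a j)) ⟩
  ∑[ i < m ] ∑[ a < q ] ∑[ j < m ] (term a i * term a j)
    ≡⟨ sum-cong-≗ (λ i → ∑-comm (λ a j → term a i * term a j)) ⟩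
  ∑[ i < m ] ∑[ j < m ] ∑[ a < q ] (term a i * term a j)
    ≡⟨ sum-cong-≗ (λ i → sum-cong-≗ (λ j → sum-cong-≗ (λ a →
         rearrange (w i) (w j) (𝟙 (c i ≟ a)) (𝟙 (c j ≟ a))))) ⟩
  ∑[ i < m ] ∑[ j < m ] ∑[ a < q ] (𝟙 (c j ≟ a) * (w i * w j * 𝟙 (c i ≟ a)))
    ≡⟨ sum-cong-≗ (λ i → sum-cong-≗ (λ j → ∑-𝟙≟ (c j) (λ a → w i * w j * 𝟙 (c i ≟ a)))) ⟩
  agreement w c ∎
  where
  open ≡-Reasoning
  term : Fin q → Fin m → ℕ
  term a i = w i * 𝟙 (c i ≟ a)
  rearrange : ∀ x y u v → x * u * (y * v) ≡ v * (x * y * u)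
  rearrange = solve-∀

q*disagreement≤ : ∀ {m q} (w : Fin m → ℕ) (c : Fin m → Fin q) →
                  q * disagreement w c ≤ (q ∸ 1) * (∑[ i < m ] w i * ∑[ i < m ] w i)
q*disagreement≤ {m} {q} w c = begin
  q * D            ≤⟨ m+n≤o⇒m≤o∸n (q * D) qD+M²≤qM² ⟩
  q * M² ∸ 1 * M²  ≡⟨ *-distribʳ-∸ M² q 1 ⟨
  (q ∸ 1) * M²     ∎
  where
  open ≤-Reasoning
  D  = disagreement w c
  M² = ∑[ i < m ] w i * ∑[ i < m ] w i
  qD+M²≤qM² : q * D + 1 * M² ≤ q * M²
  qD+M²≤qM² = begin
    q * D + 1 * M²
      ≡⟨ cong (_+_ (q * D)) (*-identityˡ M²) ⟩
    q * D + M²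
      ≡⟨ cong (λ x → q * D + x * x) (∑-count w c) ⟨
    q * D + ∑[ a < q ] count w c a * ∑[ a < q ] count w c a
      ≤⟨ +-monoʳ-≤ (q * D) (cauchy-schwarz (count w c)) ⟩
    q * D + q * ∑[ a < q ] (count w c a * count w c a)
      ≡⟨ cong (λ x → q * D + q * x) (∑-count² w c) ⟩
    q * D + q * agreement w c
      ≡⟨ *-distribˡ-+ q D (agreement w c) ⟨
    q * (D + agreement w c)
      ≡⟨ cong (q *_) (disagreement+agreement w c) ⟩
    q * M² ∎

disagreement-fibre : ∀ {m q} (c : Fin m → Fin q) (a : Fin q) → disagreement (λ i → 𝟙 (c i ≟ a)) c ≡ 0
disagreement-fibre {m} c a =
  trans (sum-cong-≗ (λ i → trans (sum-cong-≗ (λ j → 𝟙-fibre (c i) (c j))) (sum-replicate-zero m)))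
        (sum-replicate-zero m)
  where
  𝟙-fibre : ∀ x y → 𝟙 (x ≟ a) * 𝟙 (y ≟ a) * 𝟙 (¬? (x ≟ y)) ≡ 0
  𝟙-fibre x y with x ≟ a | y ≟ a
  ... | no _     | _        = refl
  ... | yes _    | no _     = refl
  ... | yes refl | yes refl with x ≟ x
  ...   | yes _  = refl
  ...   | no x≢x = contradiction refl x≢x

-- Counting distances in two ways

pairSum-H≡∑disagreement : ∀ {d} {q : Fin d → ℕ} {m} (w : Fin m → ℕ) (C : Fin m → Word d q) →
                          pairSum w (λ i j → H (C i) (C j)) ≡ ∑[ l < d ] disagreement w (λ i → C i l)
pairSum-H≡∑disagreement w C =
  trans (pairSum-cong w (λ i j → H≡∑𝟙≢ (C i) (C j)))
        (pairSum-∑ w (λ l i j → 𝟙 (¬? (C i l ≟ C j l))))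

t≤H+𝟙≟*t : ∀ {d} {q : Fin d → ℕ} {m} (C : Fin m → Word d q) {t} →
           (∀ i j → i ≢ j → t ≤ H (C i) (C j)) → ∀ i j → t ≤ H (C i) (C j) + 𝟙 (i ≟ j) * t
t≤H+𝟙≟*t C {t} t≤H i j with i ≟ j
... | yes _  = subst (t ≤_) (cong (_+_ (H (C i) (C j))) (sym (*-identityˡ t))) (m≤n+m t (H (C i) (C j)))
... | no i≢j = ≤-trans (t≤H i j i≢j) (m≤m+n (H (C i) (C j)) 0)

plotkin-count : ∀ {d} {q : Fin d → ℕ} {m} (w : Fin m → ℕ) (C : Fin m → Word d q) {t} →
                (∀ i → w i * w i ≡ w i) → (∀ i j → i ≢ j → t ≤ H (C i) (C j)) →
                ∑[ i < m ] w i * ∑[ i < m ] w i * t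
                  ≤ ∑[ l < d ] disagreement w (λ i → C i l) + ∑[ i < m ] w i * t
plotkin-count {d} {m = m} w C {t} w²≡w t≤H = begin
  M * M * t
    ≡⟨ pairSum-const w t ⟨
  pairSum w (λ _ _ → t)
    ≤⟨ pairSum-mono-≤ w (t≤H+𝟙≟*t C t≤H) ⟩
  pairSum w (λ i j → H (C i) (C j) + 𝟙 (i ≟ j) * t)
    ≡⟨ pairSum-+ w (λ i j → H (C i) (C j)) (λ i j → 𝟙 (i ≟ j) * t) ⟩
  pairSum w (λ i j → H (C i) (C j)) + pairSum w (λ i j → 𝟙 (i ≟ j) * t)
    ≡⟨ cong₂ _+_ (pairSum-H≡∑disagreement w C) (pairSum-𝟙≟ w t) ⟩
  ∑[ l < d ] disagreement w (λ i → C i l) + ∑[ i < m ] (w i * w i) * t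
    ≡⟨ cong (λ x → ∑[ l < d ] disagreement w (λ i → C i l) + x * t) (sum-cong-≗ w²≡w) ⟩
  ∑[ l < d ] disagreement w (λ i → C i l) + M * t ∎
  where
  open ≤-Reasoning
  M = ∑[ i < m ] w i

-- Passing to the rationals

fromℕ : ℕ → ℚ
fromℕ n = + n / 1

fromℕ≡mkℚ : ∀ n → fromℕ n ≡ mkℚ (+ n) 0 (Coprime.sym (Coprime.1-coprimeTo n))
fromℕ≡mkℚ n = ℚ.normalize-coprime _

fromℕ-+ : ∀ a b → fromℕ (a + b) ≡ fromℕ a ℚ.+ fromℕ b
fromℕ-+ a b rewrite fromℕ≡mkℚ a | fromℕ≡mkℚ b =
  cong (_/ 1) (trans (ℤ.pos-+ a b) (sym (cong₂ ℤ._+_ (ℤ.*-identityʳ (+ a)) (ℤ.*-identityʳ (+ b)))))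

fromℕ-* : ∀ a b → fromℕ (a * b) ≡ fromℕ a ℚ.* fromℕ b
fromℕ-* a b rewrite fromℕ≡mkℚ a | fromℕ≡mkℚ b = cong (_/ 1) (ℤ.pos-* a b)

fromℕ-mono-≤ : ∀ {a b} → a ≤ b → fromℕ a ℚ.≤ fromℕ b
fromℕ-mono-≤ {a} {b} a≤b rewrite fromℕ≡mkℚ a | fromℕ≡mkℚ b =
  *≤* (subst₂ ℤ._≤_ (sym (ℤ.*-identityʳ (+ a))) (sym (ℤ.*-identityʳ (+ b))) (ℤ.+≤+ a≤b))

fromℕ-cancel-≤ : ∀ {a b} → fromℕ a ℚ.≤ fromℕ b → a ≤ b
fromℕ-cancel-≤ {a} {b} a≤b rewrite fromℕ≡mkℚ a | fromℕ≡mkℚ b =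
  ℤ.drop‿+≤+ (subst₂ ℤ._≤_ (ℤ.*-identityʳ (+ a)) (ℤ.*-identityʳ (+ b)) (ℚ.drop-*≤* a≤b))

fromℕ-pos : ∀ n .{{_ : NonZero n}} → ℚ.Positive (fromℕ n)
fromℕ-pos n = ℚ.normalize-pos n 1

-- Computed in ℚᵘ, where both factors are the unreduced fractions q/1 and k/q.
fromℕ-*-/ : ∀ q k .{{_ : NonZero q}} → fromℕ q ℚ.* (+ k / q) ≡ fromℕ k
fromℕ-*-/ (suc q) k = ℚ.toℚᵘ-injective (begin-equality
  ℚ.toℚᵘ (fromℕ (suc q) ℚ.* (+ k / suc q))
    ≃⟨ ℚ.toℚᵘ-homo-* (fromℕ (suc q)) (+ k / suc q) ⟩
  ℚ.toℚᵘ (fromℕ (suc q)) ℚᵘ.* ℚ.toℚᵘ (+ k / suc q)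
    ≃⟨ ℚᵘ.*-cong (ℚ.toℚᵘ-fromℚᵘ (ℚᵘ.mkℚᵘ (+ suc q) 0))
                  (ℚ.toℚᵘ-fromℚᵘ (ℚᵘ.mkℚᵘ (+ k) q)) ⟩
  ℚᵘ.mkℚᵘ (+ suc q) 0 ℚᵘ.* ℚᵘ.mkℚᵘ (+ k) q
    ≃⟨ ℚᵘ.*≡* (trans (ℤ.*-identityʳ _) (trans (ℤ.*-comm (+ suc q) (+ k))
                                               (cong (λ n → + k ℤ.* + n) (sym (*-identityˡ (suc q)))))) ⟩
  ℚᵘ.mkℚᵘ (+ k) 0
    ≃⟨ ℚ.toℚᵘ-fromℚᵘ (ℚᵘ.mkℚᵘ (+ k) 0) ⟨
  ℚ.toℚᵘ (fromℕ k) ∎)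
  where open ℚᵘ.≤-Reasoning

fromℕ-∑ : ∀ {n} (f : Fin n → ℕ) → fromℕ (∑[ i < n ] f i) ≡ ℚΣ.sum (fromℕ ∘ f)
fromℕ-∑ {zero}  f = refl
fromℕ-∑ {suc n} f = trans (fromℕ-+ (f zero) _) (cong (fromℕ (f zero) ℚ.+_) (fromℕ-∑ (f ∘ suc)))

sumFin≡∑ : ∀ d (f : Fin d → ℚ) → sumFin d f ≡ ℚΣ.sum f
sumFin≡∑ zero    f = refl
sumFin≡∑ (suc d) f = cong (ℚ._+_ (f zero)) (sumFin≡∑ d (f ∘ suc))

ℚΣ-mono-≤ : ∀ {n} {f g : Fin n → ℚ} → (∀ i → f i ℚ.≤ g i) → ℚΣ.sum f ℚ.≤ ℚΣ.sum g
ℚΣ-mono-≤ {zero}  f≤g = ℚ.≤-refl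
ℚΣ-mono-≤ {suc n} f≤g = ℚ.+-mono-≤ (f≤g zero) (ℚΣ-mono-≤ (f≤g ∘ suc))

ℚΣ-mono-≤-omitting : ∀ {n} {f g : Fin n → ℚ} (i : Fin n) →
                     f i ≡ ℚ.0ℚ → (∀ j → f j ℚ.≤ g j) → ℚΣ.sum f ℚ.≤ ℚΣ.sum g ℚ.- g i
ℚΣ-mono-≤-omitting {suc n} {f} {g} i fi≡0 f≤g = begin
  ℚΣ.sum f                               ≡⟨ ℚΣ.sum-remove f ⟩
  f i ℚ.+ Σf′                            ≡⟨ cong (ℚ._+ Σf′) fi≡0 ⟩
  ℚ.0ℚ ℚ.+ Σf′                           ≡⟨ ℚ.+-identityˡ Σf′ ⟩
  Σf′                                    ≤⟨ ℚΣ-mono-≤ (f≤g ∘ punchIn i) ⟩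
  Σg′                                    ≡⟨ add-sub (g i) Σg′ ⟨
  g i ℚ.+ Σg′ ℚ.- g i                    ≡⟨ cong (ℚ._- g i) (ℚΣ.sum-remove g) ⟨
  ℚΣ.sum g ℚ.- g i                       ∎
  where
  open ℚ.≤-Reasoning
  open +-*-Solver
  Σf′ = ℚΣ.sum (removeAt f i)
  Σg′ = ℚΣ.sum (removeAt g i)
  add-sub : ∀ x y → x ℚ.+ y ℚ.- x ≡ y
  add-sub = solve 2 (λ x y → x :+ y :- x := y) refl

-- ρ q is the summand of S: S d q nz unfolds to sumFin d (λ l → ρ (q l)).
ρ : (q : ℕ) .{{_ : NonZero q}} → ℚ
ρ q = + (q ∸ 1) / q

fromℕ-*ρ : ∀ q .{{_ : NonZero q}} a → fromℕ q ℚ.* (fromℕ a ℚ.* ρ q) ≡ fromℕ ((q ∸ 1) * a)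
fromℕ-*ρ q a = begin
  fromℕ q ℚ.* (fromℕ a ℚ.* ρ q)  ≡⟨ swap (fromℕ q) (fromℕ a) (ρ q) ⟩
  fromℕ a ℚ.* (fromℕ q ℚ.* ρ q)  ≡⟨ cong (fromℕ a ℚ.*_) (fromℕ-*-/ q (q ∸ 1)) ⟩
  fromℕ a ℚ.* fromℕ (q ∸ 1)      ≡⟨ fromℕ-* a (q ∸ 1) ⟨
  fromℕ (a * (q ∸ 1))            ≡⟨ cong fromℕ (*-comm a (q ∸ 1)) ⟩
  fromℕ ((q ∸ 1) * a)            ∎
  where
  open ≡-Reasoning
  open +-*-Solver
  swap : ∀ x y z → x ℚ.* (y ℚ.* z) ≡ y ℚ.* (x ℚ.* z)
  swap = solve 3 (λ x y z → x :* (y :* z) := y :* (x :* z)) refl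

≤-*ρ : ∀ q .{{_ : NonZero q}} {a b} → q * a ≤ (q ∸ 1) * b → fromℕ a ℚ.≤ fromℕ b ℚ.* ρ q
≤-*ρ q {a} {b} qa≤[q∸1]b = ℚ.*-cancelˡ-≤-pos (fromℕ q) {{fromℕ-pos q}} (begin
  fromℕ q ℚ.* fromℕ a            ≡⟨ fromℕ-* q a ⟨
  fromℕ (q * a)                  ≤⟨ fromℕ-mono-≤ qa≤[q∸1]b ⟩
  fromℕ ((q ∸ 1) * b)            ≡⟨ fromℕ-*ρ q b ⟨
  fromℕ q ℚ.* (fromℕ b ℚ.* ρ q)  ∎)
  where open ℚ.≤-Reasoning

*ρ-≤⇔ : ∀ q .{{_ : NonZero q}} {a b} → fromℕ a ℚ.* ρ q ℚ.≤ fromℕ b ⇔ (q ∸ 1) * a ≤ q * b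
*ρ-≤⇔ q {a} {b} = mk⇔ to from
  where
  open ℚ.≤-Reasoning
  q≥0 = ℚ.pos⇒nonNeg (fromℕ q) {{fromℕ-pos q}}
  to : fromℕ a ℚ.* ρ q ℚ.≤ fromℕ b → (q ∸ 1) * a ≤ q * b
  to aρ≤b = fromℕ-cancel-≤ (begin
    fromℕ ((q ∸ 1) * a)            ≡⟨ fromℕ-*ρ q a ⟨
    fromℕ q ℚ.* (fromℕ a ℚ.* ρ q)  ≤⟨ ℚ.*-monoˡ-≤-nonNeg (fromℕ q) {{q≥0}} aρ≤b ⟩
    fromℕ q ℚ.* fromℕ b            ≡⟨ fromℕ-* q b ⟨
    fromℕ (q * b)                  ∎)
  from : (q ∸ 1) * a ≤ q * b → fromℕ a ℚ.* ρ q ℚ.≤ fromℕ b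
  from [q∸1]a≤qb = ℚ.*-cancelˡ-≤-pos (fromℕ q) {{fromℕ-pos q}} (begin
    fromℕ q ℚ.* (fromℕ a ℚ.* ρ q)  ≡⟨ fromℕ-*ρ q a ⟩
    fromℕ ((q ∸ 1) * a)            ≤⟨ fromℕ-mono-≤ [q∸1]a≤qb ⟩
    fromℕ (q * b)                  ≡⟨ fromℕ-* q b ⟩
    fromℕ q ℚ.* fromℕ b            ∎)

disagreement-≤-*ρ : ∀ {m q} .{{_ : NonZero q}} (w : Fin m → ℕ) (c : Fin m → Fin q) →
                    fromℕ (disagreement w c) ℚ.≤ fromℕ (∑[ i < m ] w i * ∑[ i < m ] w i) ℚ.* ρ q
disagreement-≤-*ρ {q = q} w c = ≤-*ρ q (q*disagreement≤ w c)

∑disagreement-≤-*S : ∀ {d} (q : Fin d → ℕ) (nz : ∀ l → NonZero (q l)) {m}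
                     (w : Fin m → ℕ) (C : Fin m → Word d q) →
                     fromℕ (∑[ l < d ] disagreement w (λ i → C i l))
                       ℚ.≤ fromℕ (∑[ i < m ] w i * ∑[ i < m ] w i) ℚ.* S d q nz
∑disagreement-≤-*S {d} q nz {m} w C = begin
  fromℕ (∑[ l < d ] D l)           ≡⟨ fromℕ-∑ D ⟩
  ℚΣ.sum (λ l → fromℕ (D l))       ≤⟨ ℚΣ-mono-≤ D≤M²r ⟩
  ℚΣ.sum (λ l → fromℕ M² ℚ.* r l)  ≡⟨ ℚΣ.*-distribˡ-sum (fromℕ M²) r ⟨
  fromℕ M² ℚ.* ℚΣ.sum r            ≡⟨ cong (fromℕ M² ℚ.*_) (sumFin≡∑ d r) ⟨
  fromℕ M² ℚ.* S d q nz            ∎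
  where
  open ℚ.≤-Reasoning
  D : Fin d → ℕ
  D l = disagreement w (λ i → C i l)
  M² = ∑[ i < m ] w i * ∑[ i < m ] w i
  r : Fin d → ℚ
  r l = ρ (q l) {{nz l}}
  D≤M²r : ∀ l → fromℕ (D l) ℚ.≤ fromℕ M² ℚ.* r l
  D≤M²r l = disagreement-≤-*ρ {{nz l}} w (λ i → C i l)

∑disagreement-≤-*[S-ρ] : ∀ {d} (q : Fin d → ℕ) (nz : ∀ l → NonZero (q l)) {m}
                         (w : Fin m → ℕ) (C : Fin m → Word d q) (l₀ : Fin d) →
                         disagreement w (λ i → C i l₀) ≡ 0 →
                         fromℕ (∑[ l < d ] disagreement w (λ i → C i l))
                           ℚ.≤ fromℕ (∑[ i < m ] w i * ∑[ i < m ] w i)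
                                 ℚ.* (S d q nz ℚ.- ρ (q l₀) {{nz l₀}})
∑disagreement-≤-*[S-ρ] {d} q nz {m} w C l₀ D₀≡0 = begin
  fromℕ (∑[ l < d ] D l)
    ≡⟨ fromℕ-∑ D ⟩
  ℚΣ.sum (λ l → fromℕ (D l))
    ≤⟨ ℚΣ-mono-≤-omitting l₀ (cong fromℕ D₀≡0) D≤M²r ⟩
  ℚΣ.sum (λ l → fromℕ M² ℚ.* r l) ℚ.- fromℕ M² ℚ.* r l₀
    ≡⟨ cong (ℚ._- fromℕ M² ℚ.* r l₀) (ℚΣ.*-distribˡ-sum (fromℕ M²) r) ⟨
  fromℕ M² ℚ.* ℚΣ.sum r ℚ.- fromℕ M² ℚ.* r l₀
    ≡⟨ cong (λ x → fromℕ M² ℚ.* x ℚ.- fromℕ M² ℚ.* r l₀) (sumFin≡∑ d r) ⟨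
  fromℕ M² ℚ.* S d q nz ℚ.- fromℕ M² ℚ.* r l₀
    ≡⟨ factor (fromℕ M²) (S d q nz) (r l₀) ⟩
  fromℕ M² ℚ.* (S d q nz ℚ.- r l₀) ∎
  where
  open ℚ.≤-Reasoning
  open +-*-Solver
  D : Fin d → ℕ
  D l = disagreement w (λ i → C i l)
  M² = ∑[ i < m ] w i * ∑[ i < m ] w i
  r : Fin d → ℚ
  r l = ρ (q l) {{nz l}}
  D≤M²r : ∀ l → fromℕ (D l) ℚ.≤ fromℕ M² ℚ.* r l
  D≤M²r l = disagreement-≤-*ρ {{nz l}} w (λ i → C i l)
  factor : ∀ x a b → x ℚ.* a ℚ.- x ℚ.* b ≡ x ℚ.* (a ℚ.- b)
  factor = solve 3 (λ x a b → x :* a :- x :* b := x :* (a :- b)) refl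

ℚ+-cancelʳ-≤ : ∀ r {p q} → p ℚ.+ r ℚ.≤ q ℚ.+ r → p ℚ.≤ q
ℚ+-cancelʳ-≤ r {p} {q} p+r≤q+r =
  subst₂ ℚ._≤_ (add-sub p r) (add-sub q r) (ℚ.+-monoˡ-≤ (ℚ.- r) p+r≤q+r)
  where
  open +-*-Solver
  add-sub : ∀ x y → x ℚ.+ y ℚ.- y ≡ x
  add-sub = solve 2 (λ x y → x :+ y :- y := x) refl

p<q⇒pos[q-p] : ∀ {p q} → p ℚ.< q → ℚ.Positive (q ℚ.- p)
p<q⇒pos[q-p] {p} {q} p<q =
  ℚ.positive (subst (ℚ._< q ℚ.- p) (ℚ.+-inverseʳ p) (ℚ.+-monoˡ-< (ℚ.- p) p<q))

≤-÷ : ∀ {p q} r .{{_ : ℚ.Positive r}} .{{_ : ℚ.NonZero r}} → p ℚ.* r ℚ.≤ q → p ℚ.≤ q ℚ.÷ r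
≤-÷ {p} {q} r pr≤q = ℚ.*-cancelʳ-≤-pos r (begin
  p ℚ.* r                ≤⟨ pr≤q ⟩
  q                      ≡⟨ ℚ.*-identityʳ q ⟨
  q ℚ.* ℚ.1ℚ             ≡⟨ cong (q ℚ.*_) (ℚ.*-inverseˡ r) ⟨
  q ℚ.* (ℚ.1/ r ℚ.* r)   ≡⟨ ℚ.*-assoc q (ℚ.1/ r) r ⟨
  q ℚ.* ℚ.1/ r ℚ.* r     ∎)
  where open ℚ.≤-Reasoning

plotkin-algebra : ∀ {M T D s : ℚ} .{{_ : ℚ.Positive M}} →
                  M ℚ.* M ℚ.* T ℚ.≤ D ℚ.+ M ℚ.* T → D ℚ.≤ M ℚ.* M ℚ.* s →
                  M ℚ.* (T ℚ.- s) ℚ.≤ T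
plotkin-algebra {M} {T} {D} {s} M²T≤D+MT D≤M²s =
  ℚ.*-cancelˡ-≤-pos M (ℚ+-cancelʳ-≤ (M ℚ.* M ℚ.* s) (begin
    M ℚ.* (M ℚ.* (T ℚ.- s)) ℚ.+ M ℚ.* M ℚ.* s  ≡⟨ expand M T s ⟩
    M ℚ.* M ℚ.* T                              ≤⟨ M²T≤D+MT ⟩
    D ℚ.+ M ℚ.* T                              ≤⟨ ℚ.+-monoˡ-≤ (M ℚ.* T) D≤M²s ⟩
    M ℚ.* M ℚ.* s ℚ.+ M ℚ.* T                  ≡⟨ ℚ.+-comm (M ℚ.* M ℚ.* s) (M ℚ.* T) ⟩
    M ℚ.* T ℚ.+ M ℚ.* M ℚ.* s                  ∎))
  where
  open ℚ.≤-Reasoning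
  open +-*-Solver
  expand : ∀ M T s → M ℚ.* (M ℚ.* (T ℚ.- s)) ℚ.+ M ℚ.* M ℚ.* s ≡ M ℚ.* M ℚ.* T
  expand = solve 3 (λ M T s → M :* (M :* (T :- s)) :+ M :* M :* s := M :* M :* T) refl

plotkin-inequality : ∀ M t D (s : ℚ) →
                     M * M * t ≤ D + M * t → fromℕ D ℚ.≤ fromℕ (M * M) ℚ.* s →
                     fromℕ M ℚ.* (fromℕ t ℚ.- s) ℚ.≤ fromℕ t
plotkin-inequality zero t D s _ _ =
  subst (ℚ._≤ fromℕ t) (sym (ℚ.*-zeroˡ (fromℕ t ℚ.- s))) (fromℕ-mono-≤ {0} {t} z≤n)
plotkin-inequality M@(suc _) t D s M²t≤D+Mt D≤M²s =
  plotkin-algebra {fromℕ M} {fromℕ t} {fromℕ D} {s} {{fromℕ-pos M}}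
    (subst₂ ℚ._≤_ (trans (fromℕ-* (M * M) t) (cong (ℚ._* fromℕ t) (fromℕ-* M M)))
                  (trans (fromℕ-+ D (M * t)) (cong (ℚ._+_ (fromℕ D)) (fromℕ-* M t)))
                  (fromℕ-mono-≤ {M * M * t} {D + M * t} M²t≤D+Mt))
    (subst (λ x → fromℕ D ℚ.≤ x ℚ.* s) (fromℕ-* M M) D≤M²s)

-- The bound (2)

plotkin-bound : ∀ {d} (q : Fin d → ℕ) (nz : ∀ l → NonZero (q l)) {m} (C : Fin m → Word d q) {t} →
                (∀ i j → i ≢ j → t ≤ H (C i) (C j)) → (S<t : S d q nz ℚ.< fromℕ t) →
                fromℕ m ℚ.≤ bound (fromℕ t) (S d q nz) S<t
plotkin-bound {d} q nz {m} C {t} t≤H S<t =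
  ≤-÷ t-S {{t-S>0}} {{ℚ.pos⇒nonZero t-S {{t-S>0}}}}
    (subst (λ M → fromℕ M ℚ.* t-S ℚ.≤ fromℕ t) (trans (∑-const m 1) (*-identityʳ m))
      (plotkin-inequality (∑[ i < m ] 1) t _ (S d q nz)
        (plotkin-count (λ _ → 1) C (λ _ → refl) t≤H) (∑disagreement-≤-*S q nz (λ _ → 1) C)))
  where
  t-S = fromℕ t ℚ.- S d q nz
  t-S>0 = p<q⇒pos[q-p] S<t

-- The bound (1)

pigeonhole : ∀ {n} (f : Fin n → ℕ) → Fin n → ∃[ a ] ∑[ i < n ] f i ≤ n * f a
pigeonhole {n} f x = a , (begin
  ∑[ i < n ] f i  ≤⟨ ∑-mono-≤ (λ i → All.lookup (f[xs]≤f[argmax] x (allFin n)) (∈-allFin i)) ⟩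
  ∑[ i < n ] f a  ≡⟨ ∑-const n (f a) ⟩
  n * f a         ∎)
  where
  open ≤-Reasoning
  a = argmax f x (allFin n)

argmin-satisfying : ∀ {p n} {P : Pred (Fin n) p} → Decidable P → (f : Fin n → ℕ) → ∀ {x} → P x →
                    ∃[ y ] P y × (∀ z → P z → f y ≤ f z)
argmin-satisfying {n = n} P? f {x} px =
  y , argmin-all f px (all-filter P? (allFin n)) ,
  λ z pz → All.lookup (f[argmin]≤f[xs] x xs) (∈-filter⁺ P? (∈-allFin z) pz)
  where
  xs = filter P? (allFin n)
  y  = argmin f x xs

≢⇒2≤ : ∀ {n} {x y : Fin n} → x ≢ y → 2 ≤ n
≢⇒2≤ {suc (suc _)}            _   = s≤s (s≤s z≤n)
≢⇒2≤ {suc zero} {zero} {zero} x≢y = contradiction refl x≢y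

-- Coordinate l₀ is constant on the fibre, which replaces S by S − ρ (q l₀) = t − ρ (q l₀).
fibre-bound : ∀ {d} (q : Fin d → ℕ) (nz : ∀ l → NonZero (q l)) {m} (C : Fin m → Word d q) {t} →
              (∀ i j → i ≢ j → t ≤ H (C i) (C j)) → fromℕ t ≡ S d q nz →
              (l₀ : Fin d) (a : Fin (q l₀)) → (q l₀ ∸ 1) * ∑[ i < m ] 𝟙 (C i l₀ ≟ a) ≤ q l₀ * t
fibre-bound {d} q nz {m} C {t} t≤H t≡S l₀ a = Equivalence.to (*ρ-≤⇔ (q l₀) {{nz l₀}})
  (subst (λ x → fromℕ (∑[ i < m ] w i) ℚ.* x ℚ.≤ fromℕ t) t-[S-ρ₀]≡ρ₀
    (plotkin-inequality (∑[ i < m ] w i) t _ (S d q nz ℚ.- ρ₀)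
      (plotkin-count w C (λ i → 𝟙*𝟙 (C i l₀ ≟ a)) t≤H)
      (∑disagreement-≤-*[S-ρ] q nz w C l₀ (disagreement-fibre (λ i → C i l₀) a))))
  where
  open +-*-Solver
  w : Fin m → ℕ
  w i = 𝟙 (C i l₀ ≟ a)
  ρ₀ = ρ (q l₀) {{nz l₀}}
  sub-sub : ∀ p r → p ℚ.- (p ℚ.- r) ≡ r
  sub-sub = solve 2 (λ p r → p :- (p :- r) := r) refl
  t-[S-ρ₀]≡ρ₀ : fromℕ t ℚ.- (S d q nz ℚ.- ρ₀) ≡ ρ₀
  t-[S-ρ₀]≡ρ₀ = trans (cong (ℚ._- (S d q nz ℚ.- ρ₀)) t≡S) (sub-sub (S d q nz) ρ₀)

M≤2*t : ∀ {q M t} → 2 ≤ q → (q ∸ 1) * M ≤ q * t → M ≤ 2 * t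
M≤2*t {suc (suc p)} {M} {t} (s≤s (s≤s _)) [q∸1]M≤qt = *-cancelˡ-≤ q (begin
  q * M            ≤⟨ *-monoˡ-≤ M (subst (q ≤_) (double p) (m≤m+n q p)) ⟩
  2 * suc p * M    ≡⟨ *-assoc 2 (suc p) M ⟩
  2 * (suc p * M)  ≤⟨ *-monoʳ-≤ 2 [q∸1]M≤qt ⟩
  2 * (q * t)      ≡⟨ x∙yz≈y∙xz 2 q t ⟩
  q * (2 * t)      ∎)
  where
  open ≤-Reasoning
  q = suc (suc p)
  double : ∀ p → suc (suc p) + p ≡ 2 * suc p
  double = solve-∀

[q∸1]*q₀≤q*q : ∀ {q q₀} → (2 ≤ q → q₀ ≤ q) → (q ∸ 1) * q₀ ≤ q * q
[q∸1]*q₀≤q*q {zero}        _    = z≤n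
[q∸1]*q₀≤q*q {suc zero}    _    = z≤n
[q∸1]*q₀≤q*q {suc (suc p)} q₀≤q = *-mono-≤ (n≤1+n (suc p)) (q₀≤q (s≤s (s≤s z≤n)))

q₀*t≤∑q : ∀ {d} (q : Fin d → ℕ) (nz : ∀ l → NonZero (q l)) {t} → fromℕ t ≡ S d q nz →
          ∀ q₀ → (∀ l → 2 ≤ q l → q₀ ≤ q l) → q₀ * t ≤ sumNat d q
q₀*t≤∑q {d} q nz {t} t≡S q₀ q₀-minimal = fromℕ-cancel-≤ (begin
  fromℕ (q₀ * t)
    ≡⟨ fromℕ-* q₀ t ⟩
  fromℕ q₀ ℚ.* fromℕ t
    ≡⟨ cong (fromℕ q₀ ℚ.*_) (trans t≡S (sumFin≡∑ d r)) ⟩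
  fromℕ q₀ ℚ.* ℚΣ.sum r
    ≡⟨ ℚΣ.*-distribˡ-sum (fromℕ q₀) r ⟩
  ℚΣ.sum (λ l → fromℕ q₀ ℚ.* r l)
    ≤⟨ ℚΣ-mono-≤ (λ l → Equivalence.from (*ρ-≤⇔ (q l) {{nz l}})
                                         ([q∸1]*q₀≤q*q (q₀-minimal l))) ⟩
  ℚΣ.sum (λ l → fromℕ (q l))
    ≡⟨ fromℕ-∑ q ⟨
  fromℕ (∑[ l < d ] q l)
    ≡⟨ cong fromℕ (sumNat≡∑ d q) ⟨
  fromℕ (sumNat d q) ∎)
  where
  open ℚ.≤-Reasoning
  r : Fin d → ℚ
  r l = ρ (q l) {{nz l}}

plotkin-equality-case : ∀ {d} (q : Fin d → ℕ) (nz : ∀ l → NonZero (q l)) {m} (C : Fin m → Word d q) →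
                        Distinct C → 2 ≤ m → ∀ {t} → (∀ i j → i ≢ j → t ≤ H (C i) (C j)) →
                        fromℕ t ≡ S d q nz → m ≤ 2 * sumNat d q
plotkin-equality-case {d} q nz {m@(suc (suc _))} C distinct (s≤s (s≤s z≤n)) {t} t≤H t≡S =
  let l₁ , C₀≢C₁             = ¬∀⟶∃¬ d _ (λ l → C zero l ≟ C (suc zero) l)
                                       (distinct zero (suc zero) (λ ()))
      l₀ , 2≤q₀ , q₀-minimal = argmin-satisfying (λ l → 2 ≤? q l) q (≢⇒2≤ C₀≢C₁)
      c                      = λ i → C i l₀
      a , ∑N≤q₀N             = pigeonhole (count (λ _ → 1) c) (c zero)
  in begin
  m
    ≡⟨ trans (∑-const m 1) (*-identityʳ m) ⟨
  ∑[ i < m ] 1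
    ≡⟨ ∑-count (λ _ → 1) c ⟨
  ∑[ b < q l₀ ] count (λ _ → 1) c b
    ≤⟨ ∑N≤q₀N ⟩
  q l₀ * count (λ _ → 1) c a
    ≡⟨ cong (q l₀ *_) (sum-cong-≗ (λ i → *-identityˡ (𝟙 (c i ≟ a)))) ⟩
  q l₀ * ∑[ i < m ] 𝟙 (c i ≟ a)
    ≤⟨ *-monoʳ-≤ (q l₀) (M≤2*t 2≤q₀ (fibre-bound q nz C t≤H t≡S l₀ a)) ⟩
  q l₀ * (2 * t)
    ≡⟨ x∙yz≈y∙xz (q l₀) 2 t ⟩
  2 * (q l₀ * t)
    ≤⟨ *-monoʳ-≤ 2 (q₀*t≤∑q q nz t≡S (q l₀) q₀-minimal) ⟩
  2 * sumNat d q ∎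
  where open ≤-Reasoning

lemma26 : (d : ℕ) (q : Fin d → ℕ) (nz : ∀ l → NonZero (q l))
          (m : ℕ) (C : Fin m → Word d q) →
          Distinct C →
          2 ≤ m →
          (t : ℕ) → IsMinDist C t →
          ((+ t / 1 ≡ S d q nz) → m ≤ 2 * sumNat d q) ×
          ((h : S d q nz < + t / 1) → (+ m / 1) ℚ.≤ bound (+ t / 1) (S d q nz) h)
lemma26 d q nz m C distinct 2≤m t (t≤H , _) =
  plotkin-equality-case q nz C distinct 2≤m t≤H , plotkin-bound q nz C t≤H
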